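{- Let $G$ be a finite simple graph on $n\ge 6$ vertices and set $k=\lceil n/2\rceil$. If $\sigma(G)\le 1/(n+2)$, then the domination polynomial $D(G,x)$ is unimodal with mode $k$, i.e. $d_0(G)\le d_1(G)\le\cdots\le d_k(G)\ge d_{k+1}(G)\ge\cdots\ge d_n(G)$.
   Context: A set $S\subseteq V(G)$ is dominating if every vertex of $G$ is in $S$ or adjacent to a vertex of $S$; $d_j(G)$ is the number of dominating sets of size $j$ and $D(G,x)=\sum_{j=0}^n d_j(G)x^j$. $\sigma(G)=\sum_{v\in V(G)}2^{ -\deg(v)-1}$. -}

module Defs where

open import Data.Bool using (Bool; true; false; _∧_; _∨_; not; if_then_else_)
open import Data.Nat using (ℕ; zero; suc; _+_; _^_; _≤_)
open import Data.Fin using (Fin)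
open import Data.Vec using (Vec; []; _∷_; lookup)
open import Data.List using (List; []; _∷_; map; _++_; length; filter; sum; allFin)
open import Data.List.Base using (foldr)
open import Data.Product using (_×_)
open import Relation.Binary.PropositionalEquality using (_≡_)
open import Relation.Nullary.Decidable using (Dec; yes; no)
open import Data.Rational using (ℚ; _+_; _/_; 0ℚ)
import Data.Integer as ℤ
open import Relation.Nullary using (¬_)

record Graph (n : ℕ) : Set where
  field
    adj       : Fin n → Fin n → Bool
    symmetric : ∀ u v → adj u v ≡ adj v u
    irreflexive : ∀ v → adj v v ≡ false
open Graph public

VSet : ℕ → Set
VSet n = Vec Bool n

allSubsets : (n : ℕ) → List (VSet n)
allSubsets zero = [] ∷ []
allSubsets (suc n) = map (true ∷_) (allSubsets n) ++ map (false ∷_) (allSubsets n)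

size : ∀ {n} → VSet n → ℕ
size [] = 0
size (true ∷ s) = suc (size s)
size (false ∷ s) = size s

anyL : ∀ {A : Set} → (A → Bool) → List A → Bool
anyL p = foldr (λ a b → p a ∨ b) false

allL : ∀ {A : Set} → (A → Bool) → List A → Bool
allL p = foldr (λ a b → p a ∧ b) true

isDominating : ∀ {n} → Graph n → VSet n → Bool
isDominating {n} G S =
  allL (λ v → lookup S v ∨ anyL (λ u → lookup S u ∧ adj G v u) (allFin n)) (allFin n)

ℕeq : ℕ → ℕ → Bool
ℕeq zero zero = true
ℕeq zero (suc _) = false
ℕeq (suc _) zero = false
ℕeq (suc a) (suc b) = ℕeq a b

d : ∀ {n} → Graph n → ℕ → ℕ
d {n} G j = length (filter (λ S → Data.Bool._≟_ (isDominating G S ∧ ℕeq (size S) j) true) (allSubsets n))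
  where import Data.Bool

deg : ∀ {n} → Graph n → Fin n → ℕ
deg {n} G v = length (filter (λ u → Data.Bool._≟_ (adj G v u) true) (allFin n))
  where import Data.Bool

σ : ∀ {n} → Graph n → ℚ
σ {n} G = foldr (λ v acc → ((ℤ.+ 1) / (2 ^ suc (deg G v))) {{pow-nz (deg G v)}} Data.Rational.+ acc) 0ℚ (allFin n)
  where
    import Data.Rational
    import Data.Nat
    pow-nz : ∀ m → Data.Nat.NonZero (2 ^ suc m)
    pow-nz m = Data.Nat.>-nonZero (Data.Nat.Properties.m^n>0 2 (suc m))
      where import Data.Nat.Properties

{-# OPTIONS --safe #-}
-- Dominating sets form an up-closed family, and for an up-closed family of subsets of an n-set,
-- double counting the pairs S ⊂ T with |T| = |S| + 1 gives (n − j)·d_j ≤ (j + 1)·d_{j+1}; so d_j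
-- is nondecreasing while 2j < n.
-- Past the middle we compare with binomial coefficients. A non-dominating set is disjoint from the
-- (open) neighbourhood N(v) of some vertex v, and when n ≤ 2i at most 2^{-deg v}·C(n,i) of the
-- i-sets avoid a fixed set of deg v vertices. Hence at most 2σ(G)·C(n,i) ≤ 2/(n+2)·C(n,i) of the
-- i-sets are not dominating, and together with (i+1)·C(n,i+1) = (n−i)·C(n,i) this gives
-- d_{i+1} ≤ C(n,i+1) ≤ d_i.
module Submission where

open import Defs
open import Data.Nat using (ℕ; _≤_; _<_; ⌈_/2⌉; suc)
open import Data.Integer using (+_)
open import Data.Product using (_×_; _,_; ∃-syntax)
open import Data.Rational using (_/_) renaming (_≤_ to _≤ℚ_)

open import Function using (_∘_; id)
open import Level using (0ℓ)
open import Data.Bool using (Bool; true; false; _∧_; _∨_; not; if_then_else_; b≤b; f≤t) renaming (_≤_ to _≤ᵇ_)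
open import Data.Bool.Properties using (∧-zeroʳ)
import Data.Bool.Properties as Boolₚ
import Data.Bool as Bool
open import Data.Nat using (zero; _+_; _*_; _∸_; _^_; z≤n; s≤s; NonZero; _<?_; ⌊_/2⌋)
open import Data.Nat.Properties
open import Data.Nat.ListAction using (sum)
open import Data.List using ([]; _∷_; map; _++_; length; filter; foldr; allFin)
import Data.List as List
open import Data.List.Membership.Propositional using (_∈_)
open import Data.List.Membership.Propositional.Properties using (∈-allFin)
open import Data.List.Relation.Unary.Any using (here; there)
open import Data.List.Properties using (filter-++; length-++)
open import Data.Vec using ([]; _∷_; lookup)
import Data.Vec as Vec
open import Data.Vec.Properties using ([]=⇒lookup; lookup⇒[]=)
open import Data.Fin using (Fin; zero; suc)
open import Data.Fin.Subset using (_⊆_)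
open import Data.Fin.Subset.Properties using (s⊆s; out⊆; ⊆-refl)
open import Relation.Binary.PropositionalEquality
open import Relation.Nullary using (does; yes; no; contradiction)
open import Relation.Unary using (Pred; Decidable)
open import Data.Nat.Tactic.RingSolver using (solve-∀)
open import Data.Integer.Tactic.RingSolver renaming (solve-∀ to ℤ-solve-∀)
import Data.Integer as ℤ
import Data.Integer.Properties as ℤₚ
open import Data.Rational using (ℚ; toℚᵘ)
import Data.Rational as ℚ
import Data.Rational.Properties as ℚₚ
open import Data.Rational.Unnormalised using (*≡*; *≤*) renaming (_≃_ to _≃ᵘ_; _≤_ to _≤ᵘ_)
import Data.Rational.Unnormalised as ℚᵘ
import Data.Rational.Unnormalised.Properties as ℚᵘₚ
open import Algebra.Properties.CommutativeSemigroup +-commutativeSemigroup using (interchange)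
open import Algebra.Properties.CommutativeSemigroup *-commutativeSemigroup using (x∙yz≈y∙xz)

module _ {A : Set} where

  sum-map-mono : ∀ {f g : A → ℕ} xs → (∀ x → f x ≤ g x) → sum (map f xs) ≤ sum (map g xs)
  sum-map-mono []       f≤g = z≤n
  sum-map-mono (x ∷ xs) f≤g = +-mono-≤ (f≤g x) (sum-map-mono xs f≤g)

  sum-map-*ˡ : ∀ c (f : A → ℕ) xs → sum (map (λ x → c * f x) xs) ≡ c * sum (map f xs)
  sum-map-*ˡ c f []       = sym (*-zeroʳ c)
  sum-map-*ˡ c f (x ∷ xs) = begin
    c * f x + sum (map (λ x → c * f x) xs) ≡⟨ cong (λ s → c * f x + s) (sum-map-*ˡ c f xs) ⟩
    c * f x + c * sum (map f xs)           ≡⟨ *-distribˡ-+ c (f x) _ ⟨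
    c * sum (map f (x ∷ xs))               ∎
    where open ≡-Reasoning

  length-filter-map : ∀ {B : Set} {P : Pred B 0ℓ} (P? : Decidable P) (g : A → B) xs →
                      length (filter P? (map g xs)) ≡ length (filter (P? ∘ g) xs)
  length-filter-map P? g []       = refl
  length-filter-map P? g (x ∷ xs) with does (P? (g x))
  ... | true  = cong suc (length-filter-map P? g xs)
  ... | false = length-filter-map P? g xs

-- Counting subsets by size

count : ∀ n → (VSet n → Bool) → ℕ → ℕ
count zero    f zero    = if f [] then 1 else 0
count zero    f (suc j) = 0
count (suc n) f zero    = count n (f ∘ (false ∷_)) zero
count (suc n) f (suc j) = count n (f ∘ (true ∷_)) j + count n (f ∘ (false ∷_)) (suc j)

binomial : ℕ → ℕ → ℕ
binomial n = count n (λ _ → true)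

private
  hasSize? : ∀ {n} (f : VSet n → Bool) j → Decidable (λ S → (f S ∧ ℕeq (size S) j) ≡ true)
  hasSize? f j S = Bool._≟_ (f S ∧ ℕeq (size S) j) true

  length-filter-allSubsets : ∀ n {P : Pred (VSet (suc n)) 0ℓ} (P? : Decidable P) →
    length (filter P? (allSubsets (suc n)))
      ≡ length (filter (P? ∘ (true ∷_)) (allSubsets n)) + length (filter (P? ∘ (false ∷_)) (allSubsets n))
  length-filter-allSubsets n P? = begin
    length (filter P? (map (true ∷_) Sₙ ++ map (false ∷_) Sₙ))
      ≡⟨ cong length (filter-++ P? (map (true ∷_) Sₙ) _) ⟩
    length (filter P? (map (true ∷_) Sₙ) ++ filter P? (map (false ∷_) Sₙ))
      ≡⟨ length-++ (filter P? (map (true ∷_) Sₙ)) ⟩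
    length (filter P? (map (true ∷_) Sₙ)) + length (filter P? (map (false ∷_) Sₙ))
      ≡⟨ cong₂ _+_ (length-filter-map P? (true ∷_) Sₙ) (length-filter-map P? (false ∷_) Sₙ) ⟩
    length (filter (P? ∘ (true ∷_)) Sₙ) + length (filter (P? ∘ (false ∷_)) Sₙ) ∎
    where
      open ≡-Reasoning
      Sₙ = allSubsets n

  length-filter-∧false : ∀ {A : Set} (h : A → Bool) xs →
                         length (filter (λ x → Bool._≟_ (h x ∧ false) true) xs) ≡ 0
  length-filter-∧false h []       = refl
  length-filter-∧false h (x ∷ xs) rewrite ∧-zeroʳ (h x) = length-filter-∧false h xs

  count-filter : ∀ n (f : VSet n → Bool) j → length (filter (hasSize? f j) (allSubsets n)) ≡ count n f j
  count-filter zero f zero with f []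
  ... | true  = refl
  ... | false = refl
  count-filter zero f (suc j) with f []
  ... | true  = refl
  ... | false = refl
  count-filter (suc n) f zero = trans (length-filter-allSubsets n (hasSize? f zero))
    (cong₂ _+_ (length-filter-∧false (f ∘ (true ∷_)) (allSubsets n)) (count-filter n (f ∘ (false ∷_)) zero))
  count-filter (suc n) f (suc j) = trans (length-filter-allSubsets n (hasSize? f (suc j)))
    (cong₂ _+_ (count-filter n (f ∘ (true ∷_)) j) (count-filter n (f ∘ (false ∷_)) (suc j)))

d≡count : ∀ {n} (G : Graph n) j → d G j ≡ count n (isDominating G) j
d≡count {n} G = count-filter n (isDominating G)

count-mono : ∀ n {f g : VSet n → Bool} j → (∀ S → f S ≤ᵇ g S) → count n f j ≤ count n g j
count-mono zero    {f} {g} zero f≤g with f [] | g [] | f≤g []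
... | _     | _    | b≤b = ≤-refl
... | false | true | f≤t = z≤n
count-mono zero    (suc j) f≤g = z≤n
count-mono (suc n) zero    f≤g = count-mono n zero (f≤g ∘ (false ∷_))
count-mono (suc n) (suc j) f≤g =
  +-mono-≤ (count-mono n j (f≤g ∘ (true ∷_))) (count-mono n (suc j) (f≤g ∘ (false ∷_)))

count-false : ∀ n j → count n (λ _ → false) j ≡ 0
count-false zero    zero    = refl
count-false zero    (suc j) = refl
count-false (suc n) zero    = count-false n zero
count-false (suc n) (suc j) = cong₂ _+_ (count-false n j) (count-false n (suc j))

count-∨ : ∀ n (f g : VSet n → Bool) j → count n (λ S → f S ∨ g S) j ≤ count n f j + count n g j
count-∨ zero    f g zero with f [] | g []
... | true  | _     = s≤s z≤n
... | false | true  = s≤s z≤n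
... | false | false = z≤n
count-∨ zero    f g (suc j) = z≤n
count-∨ (suc n) f g zero    = count-∨ n _ _ zero
count-∨ (suc n) f g (suc j) = ≤-trans
  (+-mono-≤ (count-∨ n (f ∘ (true ∷_)) (g ∘ (true ∷_)) j) (count-∨ n (f ∘ (false ∷_)) (g ∘ (false ∷_)) (suc j)))
  (≤-reflexive (interchange (count n (f ∘ (true ∷_)) j) _ _ _))

count-anyL : ∀ n {A : Set} (h : A → VSet n → Bool) xs j →
             count n (λ S → anyL (λ x → h x S) xs) j ≤ sum (map (λ x → count n (h x) j) xs)
count-anyL n h []       j = ≤-reflexive (count-false n j)
count-anyL n h (x ∷ xs) j = ≤-trans (count-∨ n (h x) _ j) (+-monoʳ-≤ (count n (h x) j) (count-anyL n h xs j))

count+count-not≡binomial : ∀ n (f : VSet n → Bool) j → count n f j + count n (not ∘ f) j ≡ binomial n j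
count+count-not≡binomial zero    f zero with f []
... | true  = refl
... | false = refl
count+count-not≡binomial zero    f (suc j) = refl
count+count-not≡binomial (suc n) f zero    = count+count-not≡binomial n _ zero
count+count-not≡binomial (suc n) f (suc j) = trans
  (interchange (count n (f ∘ (true ∷_)) j) _ _ _)
  (cong₂ _+_ (count+count-not≡binomial n (f ∘ (true ∷_)) j) (count+count-not≡binomial n (f ∘ (false ∷_)) (suc j)))

count-beyond : ∀ n (f : VSet n → Bool) {j} → n < j → count n f j ≡ 0
count-beyond zero    f {suc j} _         = refl
count-beyond (suc n) f {suc j} (s≤s n<j) = cong₂ _+_ (count-beyond n _ n<j) (count-beyond n _ (m<n⇒m<1+n n<j))

-- Binomial coefficients

binomial-ratio : ∀ n j → suc j * binomial n (suc j) ≡ (n ∸ j) * binomial n j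
binomial-ratio zero    j       = trans (*-zeroʳ (suc j)) (sym (cong (_* binomial 0 j) (0∸n≡0 j)))
binomial-ratio (suc n) zero    = begin
  1 * (binomial n 0 + binomial n 1) ≡⟨ *-identityˡ _ ⟩
  binomial n 0 + binomial n 1       ≡⟨ cong (_+_ (binomial n 0)) (sym (*-identityˡ _)) ⟩
  binomial n 0 + 1 * binomial n 1   ≡⟨ cong (_+_ (binomial n 0)) (binomial-ratio n 0) ⟩
  suc n * binomial n 0              ∎
  where open ≡-Reasoning
binomial-ratio (suc n) (suc j) = begin
  suc (suc j) * (B₁ + B₂)                       ≡⟨ pascal-regroup j B₁ B₂ ⟩
  B₁ + (suc j * B₁ + suc (suc j) * B₂)          ≡⟨ cong₂ (λ x y → B₁ + (x + y)) (binomial-ratio n j) (binomial-ratio n (suc j)) ⟩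
  B₁ + ((n ∸ j) * B₀ + (n ∸ suc j) * B₁)        ≡⟨ regroup B₀ B₁ (n ∸ j) (n ∸ suc j) ⟩
  (n ∸ j) * B₀ + suc (n ∸ suc j) * B₁           ≡⟨ cong (_+_ ((n ∸ j) * B₀)) absorb ⟩
  (n ∸ j) * B₀ + (n ∸ j) * B₁                   ≡⟨ *-distribˡ-+ (n ∸ j) B₀ B₁ ⟨
  (n ∸ j) * (B₀ + B₁)                           ∎
  where
    open ≡-Reasoning
    B₀ = binomial n j
    B₁ = binomial n (suc j)
    B₂ = binomial n (suc (suc j))
    pascal-regroup : ∀ j x y → suc (suc j) * (x + y) ≡ x + (suc j * x + suc (suc j) * y)
    pascal-regroup = solve-∀
    regroup : ∀ x y a c → y + (a * x + c * y) ≡ a * x + suc c * y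
    regroup = solve-∀
    absorb : suc (n ∸ suc j) * B₁ ≡ (n ∸ j) * B₁
    absorb with j <? n
    ... | yes j<n = cong (_* B₁) (sym (+-∸-assoc 1 j<n))
    ... | no  j≮n rewrite count-beyond n (λ _ → true) (s≤s (≮⇒≥ j≮n)) =
      trans (*-zeroʳ (suc (n ∸ suc j))) (sym (*-zeroʳ (n ∸ j)))

binomial-antitone : ∀ {n i} → n ≤ suc (i + i) → binomial n (suc i) ≤ binomial n i
binomial-antitone {n} {i} n≤2i+1 = *-cancelˡ-≤ (suc i) (begin
  suc i * binomial n (suc i) ≡⟨ binomial-ratio n i ⟩
  (n ∸ i) * binomial n i     ≤⟨ *-monoˡ-≤ (binomial n i) n∸i≤1+i ⟩
  suc i * binomial n i       ∎)
  where
    open ≤-Reasoning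
    n∸i≤1+i : n ∸ i ≤ suc i
    n∸i≤1+i = ≤-trans (∸-monoˡ-≤ i n≤2i+1) (≤-reflexive (m+n∸n≡m (suc i) i))

binomial-doubling : ∀ {m i} → suc m ≤ i + i → 2 * binomial m i ≤ binomial (suc m) i
binomial-doubling {m} {suc i} 1+m≤2i+2 = begin
  2 * binomial m (suc i)                   ≡⟨ cong (_+_ (binomial m (suc i))) (+-identityʳ _) ⟩
  binomial m (suc i) + binomial m (suc i)  ≤⟨ +-monoʳ-≤ (binomial m (suc i)) (binomial-antitone m≤2i+1) ⟩
  binomial m (suc i) + binomial m i        ≡⟨ +-comm (binomial m (suc i)) _ ⟩
  binomial (suc m) (suc i)                 ∎
  where
    open ≤-Reasoning
    m≤2i+1 : m ≤ suc (i + i)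
    m≤2i+1 = ≤-pred (≤-trans 1+m≤2i+2 (≤-reflexive (cong suc (+-suc i i))))

2^*binomial≤binomial : ∀ k m {i} → k + m ≤ i + i → 2 ^ k * binomial m i ≤ binomial (k + m) i
2^*binomial≤binomial zero    m k+m≤2i = ≤-reflexive (*-identityˡ _)
2^*binomial≤binomial (suc k) m {i} k+m≤2i = begin
  2 * 2 ^ k * binomial m i   ≡⟨ *-assoc 2 (2 ^ k) _ ⟩
  2 * (2 ^ k * binomial m i) ≤⟨ *-monoʳ-≤ 2 (2^*binomial≤binomial k m (≤-trans (n≤1+n _) k+m≤2i)) ⟩
  2 * binomial (k + m) i     ≤⟨ binomial-doubling k+m≤2i ⟩
  binomial (suc k + m) i     ∎
  where open ≤-Reasoning

size≤n : ∀ {n} (T : VSet n) → size T ≤ n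
size≤n []          = z≤n
size≤n (true ∷ T)  = s≤s (size≤n T)
size≤n (false ∷ T) = m≤n⇒m≤1+n (size≤n T)

disjoint : ∀ {n} → VSet n → VSet n → Bool
disjoint []      []      = true
disjoint (t ∷ T) (s ∷ S) = not (t ∧ s) ∧ disjoint T S

count-disjoint : ∀ n (T : VSet n) j → count n (disjoint T) j ≡ binomial (n ∸ size T) j
count-disjoint zero    []          zero    = refl
count-disjoint zero    []          (suc j) = refl
count-disjoint (suc n) (true ∷ T)  zero    = count-disjoint n T zero
count-disjoint (suc n) (true ∷ T)  (suc j) =
  trans (cong (_+ count n (disjoint T) (suc j)) (count-false n j)) (count-disjoint n T (suc j))
count-disjoint (suc n) (false ∷ T) j = begin
  count (suc n) (disjoint (false ∷ T)) j ≡⟨ split j ⟩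
  binomial (suc (n ∸ size T)) j          ≡⟨ cong (λ m → binomial m j) (+-∸-assoc 1 (size≤n T)) ⟨
  binomial (suc n ∸ size T) j            ∎
  where
    open ≡-Reasoning
    split : ∀ j → count (suc n) (disjoint (false ∷ T)) j ≡ binomial (suc (n ∸ size T)) j
    split zero    = count-disjoint n T zero
    split (suc j) = cong₂ _+_ (count-disjoint n T j) (count-disjoint n T (suc j))

2^size*count-disjoint≤binomial : ∀ n (T : VSet n) {i} → n ≤ i + i →
                                 2 ^ size T * count n (disjoint T) i ≤ binomial n i
2^size*count-disjoint≤binomial n T {i} n≤2i rewrite count-disjoint n T i =
  subst (λ m → 2 ^ size T * binomial (n ∸ size T) i ≤ binomial m i) s+[n∸s]≡n
    (2^*binomial≤binomial (size T) (n ∸ size T) (≤-trans (≤-reflexive s+[n∸s]≡n) n≤2i))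
  where
    s+[n∸s]≡n : size T + (n ∸ size T) ≡ n
    s+[n∸s]≡n = m+[n∸m]≡n (size≤n T)

-- Up-closed families

UpClosed : ∀ {n} → (VSet n → Bool) → Set
UpClosed f = ∀ {S T} → S ⊆ T → f S ≤ᵇ f T

m∸n≤1+m∸[1+n] : ∀ m n → m ∸ n ≤ suc (m ∸ suc n)
m∸n≤1+m∸[1+n] zero    zero    = z≤n
m∸n≤1+m∸[1+n] zero    (suc n) = z≤n
m∸n≤1+m∸[1+n] (suc m) zero    = ≤-refl
m∸n≤1+m∸[1+n] (suc m) (suc n) = m∸n≤1+m∸[1+n] m n

private
  module Halves {n} {f : VSet (suc n) → Bool} (up : UpClosed f) where
    c₀ c₁ : ℕ → ℕ
    c₀ = count n (f ∘ (false ∷_))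
    c₁ = count n (f ∘ (true ∷_))
    up₀ : UpClosed (f ∘ (false ∷_))
    up₀ = up ∘ s⊆s
    up₁ : UpClosed (f ∘ (true ∷_))
    up₁ = up ∘ s⊆s
    f₀≤f₁ : ∀ S → f (false ∷ S) ≤ᵇ f (true ∷ S)
    f₀≤f₁ S = up (out⊆ ⊆-refl)

count-upClosed : ∀ n {f : VSet n → Bool} → UpClosed f → ∀ j →
                 (n ∸ j) * count n f j ≤ suc j * count n f (suc j)
count-upClosed zero    up j rewrite 0∸n≡0 j = z≤n
count-upClosed (suc n) {f} up zero = begin
  suc n * c₀ 0          ≤⟨ +-mono-≤ (count-mono n 0 f₀≤f₁) (count-upClosed n up₀ 0) ⟩
  c₁ 0 + 1 * c₀ 1       ≡⟨ cong (_+_ (c₁ 0)) (*-identityˡ (c₀ 1)) ⟩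
  c₁ 0 + c₀ 1           ≡⟨ *-identityˡ _ ⟨
  1 * (c₁ 0 + c₀ 1)     ∎
  where
    open ≤-Reasoning
    open Halves up
count-upClosed (suc n) {f} up (suc j) = begin
  (n ∸ j) * (c₁ j + c₀ (suc j))                                  ≡⟨ *-distribˡ-+ (n ∸ j) _ _ ⟩
  (n ∸ j) * c₁ j + (n ∸ j) * c₀ (suc j)                          ≤⟨ +-mono-≤ (count-upClosed n up₁ j)
                                                                      (*-monoˡ-≤ (c₀ (suc j)) (m∸n≤1+m∸[1+n] n j)) ⟩
  suc j * c₁ (suc j) + (c₀ (suc j) + (n ∸ suc j) * c₀ (suc j))   ≤⟨ +-monoʳ-≤ (suc j * c₁ (suc j))
                                                                      (+-mono-≤ (count-mono n (suc j) f₀≤f₁) (count-upClosed n up₀ (suc j))) ⟩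
  suc j * c₁ (suc j) + (c₁ (suc j) + suc (suc j) * c₀ (suc (suc j))) ≡⟨ regroup j (c₁ (suc j)) (c₀ (suc (suc j))) ⟩
  suc (suc j) * (c₁ (suc j) + c₀ (suc (suc j)))                  ∎
  where
    open ≤-Reasoning
    open Halves up
    regroup : ∀ j x y → suc j * x + (x + suc (suc j) * y) ≡ suc (suc j) * (x + y)
    regroup = solve-∀

-- Dominating sets

∨-mono-≤ᵇ : ∀ {a a′ b b′} → a ≤ᵇ a′ → b ≤ᵇ b′ → a ∨ b ≤ᵇ a′ ∨ b′
∨-mono-≤ᵇ {true}  b≤b _   = b≤b
∨-mono-≤ᵇ {false} b≤b b≤b′ = b≤b′
∨-mono-≤ᵇ f≤t _ = Boolₚ.≤-maximum _

∧-mono-≤ᵇ : ∀ {a a′ b b′} → a ≤ᵇ a′ → b ≤ᵇ b′ → a ∧ b ≤ᵇ a′ ∧ b′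
∧-mono-≤ᵇ {true}  b≤b b≤b′ = b≤b′
∧-mono-≤ᵇ {false} b≤b _   = b≤b
∧-mono-≤ᵇ f≤t _ = Boolₚ.≤-minimum _

module _ {A : Set} where

  anyL-mono : ∀ {p q : A → Bool} xs → (∀ x → p x ≤ᵇ q x) → anyL p xs ≤ᵇ anyL q xs
  anyL-mono []       p≤q = b≤b
  anyL-mono (x ∷ xs) p≤q = ∨-mono-≤ᵇ (p≤q x) (anyL-mono xs p≤q)

  allL-mono : ∀ {p q : A → Bool} xs → (∀ x → p x ≤ᵇ q x) → allL p xs ≤ᵇ allL q xs
  allL-mono []       p≤q = b≤b
  allL-mono (x ∷ xs) p≤q = ∧-mono-≤ᵇ (p≤q x) (allL-mono xs p≤q)

  anyL-∈ : ∀ {p : A → Bool} {x xs} → x ∈ xs → p x ≡ true → anyL p xs ≡ true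
  anyL-∈ {p} {xs = _ ∷ ys} (here refl) px = cong (_∨ anyL p ys) px
  anyL-∈ {p} {xs = y ∷ _} (there x∈xs) px = trans (cong (p y ∨_) (anyL-∈ x∈xs px)) (Boolₚ.∨-zeroʳ (p y))

  anyL-false : ∀ {p : A → Bool} {x xs} → anyL p xs ≡ false → x ∈ xs → p x ≡ false
  anyL-false {p} {xs = y ∷ ys} eq (here refl)  = Boolₚ.∨-conicalˡ (p y) (anyL p ys) eq
  anyL-false {p} {xs = y ∷ ys} eq (there x∈ys) = anyL-false (Boolₚ.∨-conicalʳ (p y) (anyL p ys) eq) x∈ys

  allL-false : ∀ {p : A → Bool} xs → allL p xs ≡ false → ∃[ x ] p x ≡ false
  allL-false {p} (x ∷ xs) eq with p x in px
  ... | true  = allL-false xs eq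
  ... | false = x , px

lookup-mono : ∀ {n} {S T : VSet n} → S ⊆ T → ∀ u → lookup S u ≤ᵇ lookup T u
lookup-mono {S = S} S⊆T u with lookup S u in eq
... | false = Boolₚ.≤-minimum _
... | true  = Boolₚ.≤-reflexive (sym ([]=⇒lookup (S⊆T (lookup⇒[]= u S eq))))

neighbourhood : ∀ {n} → Graph n → Fin n → VSet n
neighbourhood G v = Vec.tabulate (adj G v)

size-tabulate : ∀ {A : Set} n (g : Fin n → A) (p : A → Bool) →
                length (filter (λ a → Bool._≟_ (p a) true) (List.tabulate g)) ≡ size (Vec.tabulate (p ∘ g))
size-tabulate zero    g p = refl
size-tabulate (suc n) g p with p (g zero)
... | true  = cong suc (size-tabulate n (g ∘ suc) p)
... | false = size-tabulate n (g ∘ suc) p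

deg≡size-neighbourhood : ∀ {n} (G : Graph n) v → deg G v ≡ size (neighbourhood G v)
deg≡size-neighbourhood {n} G v = size-tabulate n id (adj G v)

isDominating-upClosed : ∀ {n} (G : Graph n) → UpClosed (isDominating G)
isDominating-upClosed {n} G S⊆T = allL-mono (allFin n) λ v →
  ∨-mono-≤ᵇ (lookup-mono S⊆T v) (anyL-mono (allFin n) λ u → ∧-mono-≤ᵇ (lookup-mono S⊆T u) Boolₚ.≤-refl)

disjoint-tabulate : ∀ {n} (h : Fin n → Bool) S → (∀ u → h u ∧ lookup S u ≡ false) → disjoint (Vec.tabulate h) S ≡ true
disjoint-tabulate h []      _        = refl
disjoint-tabulate h (s ∷ S) h∩S≡∅ rewrite h∩S≡∅ zero = disjoint-tabulate (h ∘ suc) S (h∩S≡∅ ∘ suc)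

nonDominating⇒disjoint-neighbourhood : ∀ {n} (G : Graph n) S → isDominating G S ≡ false →
                                       ∃[ v ] disjoint (neighbourhood G v) S ≡ true
nonDominating⇒disjoint-neighbourhood {n} G S eq with allL-false (allFin n) eq
... | v , v-undominated = v , disjoint-tabulate (adj G v) S λ u →
  trans (Boolₚ.∧-comm (adj G v u) (lookup S u)) (anyL-false (Boolₚ.∨-conicalʳ _ _ v-undominated) (∈-allFin u))

not-isDominating≤anyL-disjoint : ∀ {n} (G : Graph n) S →
  not (isDominating G S) ≤ᵇ anyL (λ v → disjoint (neighbourhood G v) S) (allFin n)
not-isDominating≤anyL-disjoint G S with isDominating G S in eq
... | true  = Boolₚ.≤-minimum _
... | false with nonDominating⇒disjoint-neighbourhood G S eq
...   | v , disjoint-Nv = Boolₚ.≤-reflexive (sym (anyL-∈ (∈-allFin v) disjoint-Nv))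

-- The weight σ(G)

toℚᵘ-/ : ∀ a m .{{_ : NonZero m}} → toℚᵘ (+ a ℚ./ m) ≃ᵘ + a ℚᵘ./ m
toℚᵘ-/ a (suc m) = ℚₚ.toℚᵘ-fromℚᵘ (ℚᵘ.mkℚᵘ (+ a) m)

a*m≡b*k⇒a/k≃b/m : ∀ {a b} k m .{{_ : NonZero k}} .{{_ : NonZero m}} → a * m ≡ b * k → + a ℚᵘ./ k ≃ᵘ + b ℚᵘ./ m
a*m≡b*k⇒a/k≃b/m {a} {b} (suc k) (suc m) eq = *≡* (begin
  + a ℤ.* + suc m ≡⟨ ℤₚ.pos-* a (suc m) ⟨
  + (a * suc m)   ≡⟨ cong +_ eq ⟩
  + (b * suc k)   ≡⟨ ℤₚ.pos-* b (suc k) ⟩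
  + b ℤ.* + suc k ∎)
  where open ≡-Reasoning

a/k≤b/m⇒a*m≤b*k : ∀ {a b} k m .{{_ : NonZero k}} .{{_ : NonZero m}} → + a ℚᵘ./ k ≤ᵘ + b ℚᵘ./ m → a * m ≤ b * k
a/k≤b/m⇒a*m≤b*k {a} {b} (suc k) (suc m) (*≤* le) =
  ℤₚ.drop‿+≤+ (subst₂ ℤ._≤_ (sym (ℤₚ.pos-* a (suc m))) (sym (ℤₚ.pos-* b (suc k))) le)

a/m+b/m≃[a+b]/m : ∀ a b m .{{_ : NonZero m}} → (+ a ℚᵘ./ m) ℚᵘ.+ (+ b ℚᵘ./ m) ≃ᵘ + (a + b) ℚᵘ./ m
a/m+b/m≃[a+b]/m a b m@(suc _) = *≡* (begin
  (+ a ℤ.* + m ℤ.+ + b ℤ.* + m) ℤ.* + m ≡⟨ factor (+ a) (+ b) (+ m) ⟩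
  (+ a ℤ.+ + b) ℤ.* (+ m ℤ.* + m)       ≡⟨ cong₂ ℤ._*_ (ℤₚ.pos-+ a b) (ℤₚ.pos-* m m) ⟨
  + (a + b) ℤ.* + (m * m)               ∎)
  where
    open ≡-Reasoning
    factor : ∀ x y z → (x ℤ.* z ℤ.+ y ℤ.* z) ℤ.* z ≡ (x ℤ.+ y) ℤ.* (z ℤ.* z)
    factor = ℤ-solve-∀

toℚᵘ-foldr-/ : ∀ {A : Set} (q : A → ℚ) (h : A → ℕ) m .{{_ : NonZero m}} →
               (∀ x → toℚᵘ (q x) ≃ᵘ + h x ℚᵘ./ m) →
               ∀ xs → toℚᵘ (foldr (λ x acc → q x ℚ.+ acc) ℚ.0ℚ xs) ≃ᵘ + sum (map h xs) ℚᵘ./ m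
toℚᵘ-foldr-/ q h m q≃h/m []       = a*m≡b*k⇒a/k≃b/m 1 m refl
toℚᵘ-foldr-/ q h m q≃h/m (x ∷ xs) = ℚᵘₚ.≃-trans (ℚₚ.toℚᵘ-homo-+ (q x) _)
  (ℚᵘₚ.≃-trans (ℚᵘₚ.+-cong (q≃h/m x) (toℚᵘ-foldr-/ q h m q≃h/m xs)) (a/m+b/m≃[a+b]/m (h x) _ m))

deg≤n : ∀ {n} (G : Graph n) v → deg G v ≤ n
deg≤n G v = subst (_≤ _) (sym (deg≡size-neighbourhood G v)) (size≤n (neighbourhood G v))

σ-numerator : ∀ {n} → Graph n → ℕ
σ-numerator {n} G = sum (map (λ v → 2 ^ (n ∸ deg G v)) (allFin n))

module _ {n} (G : Graph n) where

  private instance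
    2^[1+n]≢0 : NonZero (2 ^ suc n)
    2^[1+n]≢0 = m^n≢0 2 (suc n)

  σ≃σ-numerator/2^[1+n] : toℚᵘ (σ G) ≃ᵘ + σ-numerator G ℚᵘ./ 2 ^ suc n
  σ≃σ-numerator/2^[1+n] = toℚᵘ-foldr-/ (λ v → (+ 1 ℚ./ 2 ^ suc (deg G v)) {{m^n≢0 2 (suc (deg G v))}})
                                         (λ v → 2 ^ (n ∸ deg G v)) (2 ^ suc n) term (allFin n)
    where
      term : ∀ v → toℚᵘ ((+ 1 ℚ./ 2 ^ suc (deg G v)) {{m^n≢0 2 (suc (deg G v))}}) ≃ᵘ + 2 ^ (n ∸ deg G v) ℚᵘ./ 2 ^ suc n
      term v = ℚᵘₚ.≃-trans (toℚᵘ-/ 1 (2 ^ suc (deg G v)))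
                           (a*m≡b*k⇒a/k≃b/m (2 ^ suc (deg G v)) (2 ^ suc n) 1*2^[1+n]≡2^[n∸d]*2^[1+d])
        where
          instance
            2^[1+d]≢0 : NonZero (2 ^ suc (deg G v))
            2^[1+d]≢0 = m^n≢0 2 (suc (deg G v))
          open ≡-Reasoning
          1*2^[1+n]≡2^[n∸d]*2^[1+d] : 1 * 2 ^ suc n ≡ 2 ^ (n ∸ deg G v) * 2 ^ suc (deg G v)
          1*2^[1+n]≡2^[n∸d]*2^[1+d] = begin
            1 * 2 ^ suc n                                 ≡⟨ *-identityˡ _ ⟩
            2 ^ suc n                                     ≡⟨ cong (2 ^_) (m∸n+n≡m (s≤s (deg≤n G v))) ⟨
            2 ^ (suc n ∸ suc (deg G v) + suc (deg G v))   ≡⟨ ^-distribˡ-+-* 2 (n ∸ deg G v) _ ⟩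
            2 ^ (n ∸ deg G v) * 2 ^ suc (deg G v)         ∎

  σ≤1/[2+n]⇒ : σ G ≤ℚ (+ 1) / suc (suc n) → suc (suc n) * σ-numerator G ≤ 2 ^ suc n
  σ≤1/[2+n]⇒ σ≤ = begin
    suc (suc n) * σ-numerator G ≡⟨ *-comm (suc (suc n)) (σ-numerator G) ⟩
    σ-numerator G * suc (suc n) ≤⟨ a/k≤b/m⇒a*m≤b*k (2 ^ suc n) (suc (suc n)) numerator/2^[1+n]≤1/[2+n] ⟩
    1 * 2 ^ suc n               ≡⟨ *-identityˡ _ ⟩
    2 ^ suc n                   ∎
    where
      open ≤-Reasoning
      numerator/2^[1+n]≤1/[2+n] : + σ-numerator G ℚᵘ./ 2 ^ suc n ≤ᵘ + 1 ℚᵘ./ suc (suc n)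
      numerator/2^[1+n]≤1/[2+n] = ℚᵘₚ.≤-respʳ-≃ (toℚᵘ-/ 1 (suc (suc n)))
        (ℚᵘₚ.≤-respˡ-≃ σ≃σ-numerator/2^[1+n] (ℚₚ.toℚᵘ-mono-≤ σ≤))

count-nonDominating : ∀ {n} (G : Graph n) {i} → n ≤ i + i → suc (suc n) * σ-numerator G ≤ 2 ^ suc n →
                      suc (suc n) * count n (not ∘ isDominating G) i ≤ 2 * binomial n i
count-nonDominating {n} G {i} n≤2i numerator≤ = *-cancelˡ-≤ (2 ^ n) {{m^n≢0 2 n}} (begin
  2 ^ n * (suc (suc n) * N) ≤⟨ *-monoʳ-≤ (2 ^ n) (*-monoʳ-≤ (suc (suc n)) N≤A) ⟩
  2 ^ n * (suc (suc n) * A) ≡⟨ x∙yz≈y∙xz (2 ^ n) (suc (suc n)) A ⟩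
  suc (suc n) * (2 ^ n * A) ≤⟨ *-monoʳ-≤ (suc (suc n)) 2^n*A≤B*W ⟩
  suc (suc n) * (B * W)     ≡⟨ x∙yz≈y∙xz (suc (suc n)) B W ⟩
  B * (suc (suc n) * W)     ≤⟨ *-monoʳ-≤ B numerator≤ ⟩
  B * (2 * 2 ^ n)           ≡⟨ regroup B (2 ^ n) ⟩
  2 ^ n * (2 * B)           ∎)
  where
    open ≤-Reasoning
    N = count n (not ∘ isDominating G) i
    B = binomial n i
    W = σ-numerator G
    missing : Fin n → ℕ
    missing v = count n (disjoint (neighbourhood G v)) i
    A = sum (map missing (allFin n))
    N≤A : N ≤ A
    N≤A = ≤-trans (count-mono n i (not-isDominating≤anyL-disjoint G))
                  (count-anyL n (disjoint ∘ neighbourhood G) (allFin n) i)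
    2^n*missing≤B*2^[n∸deg] : ∀ v → 2 ^ n * missing v ≤ B * 2 ^ (n ∸ deg G v)
    2^n*missing≤B*2^[n∸deg] v rewrite deg≡size-neighbourhood G v = begin
      2 ^ n * missing v                  ≡⟨ cong (λ k → 2 ^ k * missing v) (m∸n+n≡m (size≤n Nv)) ⟨
      2 ^ (n ∸ s + s) * missing v        ≡⟨ cong (_* missing v) (^-distribˡ-+-* 2 (n ∸ s) s) ⟩
      2 ^ (n ∸ s) * 2 ^ s * missing v    ≡⟨ *-assoc (2 ^ (n ∸ s)) (2 ^ s) (missing v) ⟩
      2 ^ (n ∸ s) * (2 ^ s * missing v)  ≤⟨ *-monoʳ-≤ (2 ^ (n ∸ s)) (2^size*count-disjoint≤binomial n Nv n≤2i) ⟩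
      2 ^ (n ∸ s) * B                    ≡⟨ *-comm (2 ^ (n ∸ s)) B ⟩
      B * 2 ^ (n ∸ s)                    ∎
      where
        Nv = neighbourhood G v
        s = size Nv
    2^n*A≤B*W : 2 ^ n * A ≤ B * W
    2^n*A≤B*W = begin
      2 ^ n * A                                          ≡⟨ sum-map-*ˡ (2 ^ n) missing (allFin n) ⟨
      sum (map (λ v → 2 ^ n * missing v) (allFin n))     ≤⟨ sum-map-mono (allFin n) 2^n*missing≤B*2^[n∸deg] ⟩
      sum (map (λ v → B * 2 ^ (n ∸ deg G v)) (allFin n)) ≡⟨ sum-map-*ˡ B (λ v → 2 ^ (n ∸ deg G v)) (allFin n) ⟩
      B * W                                              ∎
    regroup : ∀ x y → x * (2 * y) ≡ y * (2 * x)
    regroup = solve-∀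

-- Unimodality

2[1+i]≤[2+n]*e : ∀ {n i a e} → i + a ≡ n → a + e ≡ suc i → a ≤ i → 2 * suc i ≤ suc (suc n) * e
2[1+i]≤[2+n]*e {e = zero} _ a+0≡1+i a≤i = contradiction (subst (_≤ _) (trans (sym (+-identityʳ _)) a+0≡1+i) a≤i) (1+n≰n)
2[1+i]≤[2+n]*e {i = i} {a} {e = suc zero} refl a+1≡1+i a≤i rewrite suc-injective (trans (+-comm 1 a) a+1≡1+i) =
  ≤-reflexive (double i)
  where
    double : ∀ i → 2 * suc i ≡ suc (suc (i + i)) * 1
    double = solve-∀
2[1+i]≤[2+n]*e {n} {i} {e = suc (suc e)} refl _ _ = begin
  2 * suc i             ≤⟨ *-monoʳ-≤ 2 (m≤n⇒m≤1+n (s≤s (m≤m+n i _))) ⟩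
  2 * suc (suc n)       ≡⟨ *-comm 2 (suc (suc n)) ⟩
  suc (suc n) * 2       ≤⟨ *-monoʳ-≤ (suc (suc n)) (s≤s (s≤s z≤n)) ⟩
  suc (suc n) * suc (suc e) ∎
  where open ≤-Reasoning

count-decreasing : ∀ n (f : VSet n → Bool) {i} → i < n → n ≤ i + i →
                 suc (suc n) * count n (not ∘ f) i ≤ 2 * binomial n i → count n f (suc i) ≤ count n f i
count-decreasing n f {i} i<n n≤2i few = *-cancelˡ-≤ (suc i) (+-cancelʳ-≤ (suc i * N) _ _ (begin
  suc i * c₁ + suc i * N  ≤⟨ +-monoˡ-≤ (suc i * N) (*-monoʳ-≤ (suc i) c₁≤B₁) ⟩
  suc i * B₁ + suc i * N  ≡⟨ cong (_+ suc i * N) (binomial-ratio n i) ⟩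
  a * B + suc i * N       ≤⟨ +-monoʳ-≤ (a * B) missing≤e*B ⟩
  a * B + e * B           ≡⟨ *-distribʳ-+ B a e ⟨
  (a + e) * B             ≡⟨ cong (_* B) a+e≡1+i ⟩
  suc i * B               ≡⟨ cong (suc i *_) (count+count-not≡binomial n f i) ⟨
  suc i * (c + N)         ≡⟨ *-distribˡ-+ (suc i) c N ⟩
  suc i * c + suc i * N   ∎))
  where
    open ≤-Reasoning
    c = count n f i
    c₁ = count n f (suc i)
    N = count n (not ∘ f) i
    B = binomial n i
    B₁ = binomial n (suc i)
    a = n ∸ i
    e = suc i ∸ a
    i+a≡n : i + a ≡ n
    i+a≡n = m+[n∸m]≡n (<⇒≤ i<n)
    a≤i : a ≤ i
    a≤i = ≤-trans (∸-monoˡ-≤ i n≤2i) (≤-reflexive (m+n∸m≡n i i))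
    a+e≡1+i : a + e ≡ suc i
    a+e≡1+i = m+[n∸m]≡n (m≤n⇒m≤1+n a≤i)
    c₁≤B₁ : c₁ ≤ B₁
    c₁≤B₁ = count-mono n (suc i) (Boolₚ.≤-maximum ∘ f)
    missing≤e*B : suc i * N ≤ e * B
    missing≤e*B = *-cancelˡ-≤ (suc (suc n)) (begin
      suc (suc n) * (suc i * N) ≡⟨ x∙yz≈y∙xz (suc (suc n)) (suc i) N ⟩
      suc i * (suc (suc n) * N) ≤⟨ *-monoʳ-≤ (suc i) few ⟩
      suc i * (2 * B)           ≡⟨ *-assoc (suc i) 2 B ⟨
      suc i * 2 * B             ≡⟨ cong (_* B) (*-comm (suc i) 2) ⟩
      2 * suc i * B             ≤⟨ *-monoˡ-≤ B (2[1+i]≤[2+n]*e i+a≡n a+e≡1+i a≤i) ⟩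
      suc (suc n) * e * B       ≡⟨ *-assoc (suc (suc n)) e B ⟩
      suc (suc n) * (e * B)     ∎)

count-increasing : ∀ {n} {f : VSet n → Bool} → UpClosed f → ∀ {i} → suc (i + i) ≤ n → count n f i ≤ count n f (suc i)
count-increasing {n} {f} up {i} 1+2i≤n = *-cancelˡ-≤ (suc i) (begin
  suc i * count n f i       ≤⟨ *-monoˡ-≤ (count n f i) (m+n≤o⇒m≤o∸n (suc i) 1+2i≤n) ⟩
  (n ∸ i) * count n f i     ≤⟨ count-upClosed n up i ⟩
  suc i * count n f (suc i) ∎)
  where open ≤-Reasoning

i<⌈n/2⌉⇒1+2i≤n : ∀ {n i} → i < ⌈ n /2⌉ → suc (i + i) ≤ n
i<⌈n/2⌉⇒1+2i≤n {n} {i} i<⌈n/2⌉ = ≰⇒> λ n≤2i →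
  <⇒≱ i<⌈n/2⌉ (≤-trans (⌈n/2⌉-mono n≤2i) (≤-reflexive (sym (n≡⌈n+n/2⌉ i))))

⌈n/2⌉≤i⇒n≤2i : ∀ {n i} → ⌈ n /2⌉ ≤ i → n ≤ i + i
⌈n/2⌉≤i⇒n≤2i {n} {i} ⌈n/2⌉≤i = begin
  n                     ≡⟨ ⌊n/2⌋+⌈n/2⌉≡n n ⟨
  ⌊ n /2⌋ + ⌈ n /2⌉     ≤⟨ +-monoˡ-≤ ⌈ n /2⌉ (⌊n/2⌋≤⌈n/2⌉ n) ⟩
  ⌈ n /2⌉ + ⌈ n /2⌉     ≤⟨ +-mono-≤ ⌈n/2⌉≤i ⌈n/2⌉≤i ⟩
  i + i                 ∎
  where open ≤-Reasoning

proposition11 : (n : ℕ) → 6 ≤ n → (G : Graph n) →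
    σ G ≤ℚ ((+ 1) / suc (suc n)) →
    (∀ i → i < ⌈ n /2⌉ → d G i ≤ d G (suc i)) ×
    (∀ i → ⌈ n /2⌉ ≤ i → i < n → d G (suc i) ≤ d G i)
proposition11 n _ G σ≤ = rising , falling
  where
    rising : ∀ i → i < ⌈ n /2⌉ → d G i ≤ d G (suc i)
    rising i i<⌈n/2⌉ rewrite d≡count G i | d≡count G (suc i) =
      count-increasing (isDominating-upClosed G) (i<⌈n/2⌉⇒1+2i≤n i<⌈n/2⌉)
    falling : ∀ i → ⌈ n /2⌉ ≤ i → i < n → d G (suc i) ≤ d G i
    falling i ⌈n/2⌉≤i i<n rewrite d≡count G i | d≡count G (suc i) =
      count-decreasing n (isDominating G) i<n n≤2i (count-nonDominating G n≤2i (σ≤1/[2+n]⇒ G σ≤))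
      where
        n≤2i : n ≤ i + i
        n≤2i = ⌈n/2⌉≤i⇒n≤2i ⌈n/2⌉≤i
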